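{- Let $k$ be a positive integer with $a=k+1$ odd, let $n=(a+3)\left\lfloor\frac{a-1}{6}\right\rfloor$, and define $f:\{0,1,\ldots,n-1\}\to\{ -1,1\}$ by $f(j)=-1$ if $j\bmod a<\frac{a-3}{2}$ and $f(j)=1$ if $j\bmod a\ge\frac{a-3}{2}$ (where $j\bmod a\in\{0,\ldots,a-1\}$). Then for every $k$-term arithmetic progression $A\subseteq\{0,1,\ldots,n-1\}$, $\sum_{j\in A}f(j)\ne0$. -}

module Defs where

open import Data.Nat using (ℕ; zero; suc; _+_; _*_; _∸_; _<ᵇ_; _<_)
open import Data.Nat.DivMod using (_/_; _%_)
open import Data.Bool using (if_then_else_)
open import Data.Integer using (ℤ; +_; -_)
import Data.Integer as ℤ

nOf : ℕ → ℕ
nOf k = (k + 1 + 3) * ((k + 1 ∸ 1) / 6)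

-- f(j) = -1 if j mod a < (a-3)/2, else 1, with a = k + 1.
-- (a odd, a ≥ 3 under the hypotheses, so (a-3)/2 is the natural (a ∸ 3)/2.)
f : ℕ → ℕ → ℤ
f k j = if (j % suc k) <ᵇ ((suc k ∸ 3) / 2) then - (+ 1) else + 1

apSum : (ℕ → ℤ) → ℕ → ℕ → ℕ → ℤ
apSum g b d zero = + 0
apSum g b d (suc m) = g (b + m * d) ℤ.+ apSum g b d m

-- Write k = 2(t + 1), so that a = 2t + 3 and f(j) = -1 exactly when j mod a < t. A k-term
-- progression with sum 0 has exactly t + 1 terms with residue below t, hence its extension to a
-- terms has t + 1 or t + 2 of them. The residues of a progression with difference d repeat with
-- period a / g, where g = gcd(a, d), so this count over a terms is a multiple of g; as 2t + 3 is
-- coprime to both t + 1 and t + 2, g = 1. But then the first a residues are pairwise distinct, and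
-- at most t of them lie below t.
module Submission where

open import Defs
open import Data.Bool using (Bool; true; false; T; if_then_else_)
open import Data.Empty using (⊥; ⊥-elim)
open import Data.Integer as ℤ using (ℤ; +_; -_)
import Data.Integer.Properties as ℤP
open import Data.Integer.Tactic.RingSolver using () renaming (solve-∀ to solve-∀ℤ)
open import Data.Nat using (ℕ; zero; suc; _+_; _*_; _∸_; _≤_; _<_; _<ᵇ_; _≡ᵇ_; z≤n; NonZero; >-nonZero)
open import Data.Nat.Coprimality using (Coprime; coprime-divisor; gcd≡1⇒coprime)
open import Data.Nat.DivMod using (_/_; _%_; m≡m%n+[m/n]*n; m*n/n≡m; %-remove-+ʳ)
open import Data.Nat.Divisibility using (_∣_; divides; ∣⇒≤; ∣1⇒≡1; ∣m+n∣m⇒∣n; ∣m⇒∣m*n)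
open import Data.Nat.GCD using (gcd; gcd[m,n]∣m; gcd[m,n]∣n)
open import Data.Nat.Properties
open import Algebra.Properties.CommutativeSemigroup +-commutativeSemigroup using (interchange)
open import Algebra.Properties.CommutativeSemigroup *-commutativeSemigroup using (x∙yz≈y∙xz)
open import Data.Nat.Tactic.RingSolver using () renaming (solve-∀ to solve-∀ℕ)
open import Data.Product using (_,_)
open import Relation.Binary.Definitions using (tri<; tri≈; tri>)
open import Relation.Binary.PropositionalEquality
  using (_≡_; _≢_; refl; sym; trans; cong; cong₂; subst; module ≡-Reasoning)

sumBelow : ℕ → (ℕ → ℕ) → ℕ
sumBelow zero    h = 0
sumBelow (suc n) h = h n + sumBelow n h

sumBelow-cong : ∀ n {h h′ : ℕ → ℕ} → (∀ i → h i ≡ h′ i) → sumBelow n h ≡ sumBelow n h′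
sumBelow-cong zero    eq = refl
sumBelow-cong (suc n) eq = cong₂ _+_ (eq n) (sumBelow-cong n eq)

sumBelow-+ : ∀ m n (h : ℕ → ℕ) → sumBelow (m + n) h ≡ sumBelow n (λ i → h (m + i)) + sumBelow m h
sumBelow-+ m zero    h = cong (λ x → sumBelow x h) (+-identityʳ m)
sumBelow-+ m (suc n) h = begin
  sumBelow (m + suc n) h                                      ≡⟨ cong (λ x → sumBelow x h) (+-suc m n) ⟩
  h (m + n) + sumBelow (m + n) h                              ≡⟨ cong (λ s → h (m + n) + s) (sumBelow-+ m n h) ⟩
  h (m + n) + (sumBelow n (λ i → h (m + i)) + sumBelow m h)   ≡⟨ sym (+-assoc (h (m + n)) _ _) ⟩
  sumBelow (suc n) (λ i → h (m + i)) + sumBelow m h           ∎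
  where open ≡-Reasoning

sumBelow-periodic : ∀ (h : ℕ → ℕ) q → (∀ i → h (q + i) ≡ h i) → ∀ m → sumBelow (m * q) h ≡ m * sumBelow q h
sumBelow-periodic h q per zero    = refl
sumBelow-periodic h q per (suc m) = begin
  sumBelow (q + m * q) h                             ≡⟨ sumBelow-+ q (m * q) h ⟩
  sumBelow (m * q) (λ i → h (q + i)) + sumBelow q h  ≡⟨ cong (_+ sumBelow q h) (sumBelow-cong (m * q) per) ⟩
  sumBelow (m * q) h + sumBelow q h                  ≡⟨ cong (_+ sumBelow q h) (sumBelow-periodic h q per m) ⟩
  m * sumBelow q h + sumBelow q h                    ≡⟨ +-comm (m * sumBelow q h) _ ⟩
  suc m * sumBelow q h                               ∎
  where open ≡-Reasoning

sumBelow-+-distrib : ∀ n (h h′ : ℕ → ℕ) → sumBelow n (λ i → h i + h′ i) ≡ sumBelow n h + sumBelow n h′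
sumBelow-+-distrib zero    h h′ = refl
sumBelow-+-distrib (suc n) h h′ = begin
  (h n + h′ n) + sumBelow n (λ i → h i + h′ i)   ≡⟨ cong (λ s → (h n + h′ n) + s) (sumBelow-+-distrib n h h′) ⟩
  (h n + h′ n) + (sumBelow n h + sumBelow n h′)  ≡⟨ interchange (h n) (h′ n) (sumBelow n h) (sumBelow n h′) ⟩
  (h n + sumBelow n h) + (h′ n + sumBelow n h′)  ∎
  where open ≡-Reasoning

indicator : Bool → ℕ
indicator false = 0
indicator true  = 1

count : (ℕ → Bool) → ℕ → ℕ
count p n = sumBelow n (λ i → indicator (p i))

count≡0 : ∀ {p} n → (∀ {i} → i < n → T (p i) → ⊥) → count p n ≡ 0
count≡0 zero    none = refl
count≡0 {p} (suc n) none with p n in pn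
... | true  = ⊥-elim (none (n<1+n n) (subst T (sym pn) _))
... | false = count≡0 n (λ i<n → none (m<n⇒m<1+n i<n))

InjectiveBelow : ℕ → (ℕ → ℕ) → Set
InjectiveBelow n r = ∀ {i j} → i < n → j < n → r i ≡ r j → i ≡ j

count-≡ᵇ-≤1 : ∀ {r} n v → InjectiveBelow n r → count (λ i → r i ≡ᵇ v) n ≤ 1
count-≡ᵇ-≤1 zero v inj = z≤n
count-≡ᵇ-≤1 {r} (suc n) v inj with r n ≡ᵇ v in rn≡ᵇv
... | false = count-≡ᵇ-≤1 n v (λ i<n j<n → inj (m<n⇒m<1+n i<n) (m<n⇒m<1+n j<n))
... | true  = ≤-reflexive (cong suc (count≡0 n absent))
  where
  absent : ∀ {i} → i < n → T (r i ≡ᵇ v) → ⊥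
  absent {i} i<n ri≡ᵇv = <-irrefl (inj (m<n⇒m<1+n i<n) (n<1+n n) ri≡rn) i<n
    where
    ri≡rn : r i ≡ r n
    ri≡rn = trans (≡ᵇ⇒≡ (r i) v ri≡ᵇv) (sym (≡ᵇ⇒≡ (r n) v (subst T (sym rn≡ᵇv) _)))

indicator-<ᵇ-suc : ∀ x v → indicator (x <ᵇ suc v) ≡ indicator (x <ᵇ v) + indicator (x ≡ᵇ v)
indicator-<ᵇ-suc zero    zero    = refl
indicator-<ᵇ-suc zero    (suc v) = refl
indicator-<ᵇ-suc (suc x) zero    = refl
indicator-<ᵇ-suc (suc x) (suc v) = indicator-<ᵇ-suc x v

count-<ᵇ-≤ : ∀ {r} n → InjectiveBelow n r → ∀ v → count (λ i → r i <ᵇ v) n ≤ v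
count-<ᵇ-≤ n inj zero = ≤-reflexive (count≡0 n (λ _ ()))
count-<ᵇ-≤ {r} n inj (suc v) = begin
  count (λ i → r i <ᵇ suc v) n                               ≡⟨ sumBelow-cong n (λ i → indicator-<ᵇ-suc (r i) v) ⟩
  sumBelow n (λ i → indicator (r i <ᵇ v) + indicator (r i ≡ᵇ v))
                                                             ≡⟨ sumBelow-+-distrib n _ _ ⟩
  count (λ i → r i <ᵇ v) n + count (λ i → r i ≡ᵇ v) n        ≤⟨ +-mono-≤ (count-<ᵇ-≤ n inj v) (count-≡ᵇ-≤1 n v inj) ⟩
  v + 1                                                      ≡⟨ +-comm v 1 ⟩
  suc v                                                      ∎
  where open ≤-Reasoning

m%n≡[m+o]%n⇒n∣o : ∀ m o {n} .{{_ : NonZero n}} → m % n ≡ (m + o) % n → n ∣ o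
m%n≡[m+o]%n⇒n∣o m o {n} eq = divides ((m + o) / n ∸ m / n) (begin
  o                                                       ≡⟨ sym (m+n∸m≡n m o) ⟩
  (m + o) ∸ m                                             ≡⟨ cong₂ _∸_ (m≡m%n+[m/n]*n (m + o) n) (m≡m%n+[m/n]*n m n) ⟩
  ((m + o) % n + (m + o) / n * n) ∸ (m % n + m / n * n)   ≡⟨ cong (λ r → (r + (m + o) / n * n) ∸ (m % n + m / n * n)) (sym eq) ⟩
  (m % n + (m + o) / n * n) ∸ (m % n + m / n * n)         ≡⟨ [m+n]∸[m+o]≡n∸o (m % n) _ _ ⟩
  (m + o) / n * n ∸ m / n * n                             ≡⟨ sym (*-distribʳ-∸ n ((m + o) / n) (m / n)) ⟩
  ((m + o) / n ∸ m / n) * n                               ∎)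
  where open ≡-Reasoning

b+[m+n]*d≡b+n*d+m*d : ∀ b m n d → b + (m + n) * d ≡ b + n * d + m * d
b+[m+n]*d≡b+n*d+m*d = solve-∀ℕ

module _ (a b d : ℕ) .{{_ : NonZero a}} where

  residue : ℕ → ℕ
  residue i = (b + i * d) % a

  residue-periodic : ∀ {q} → a ∣ q * d → ∀ i → residue (q + i) ≡ residue i
  residue-periodic {q} a∣qd i = begin
    (b + (q + i) * d) % a      ≡⟨ cong (_% a) (b+[m+n]*d≡b+n*d+m*d b q i d) ⟩
    (b + i * d + q * d) % a    ≡⟨ %-remove-+ʳ (b + i * d) a∣qd ⟩
    (b + i * d) % a            ∎
    where open ≡-Reasoning

  residue-≡⇒∣ : ∀ {i j} → i ≤ j → residue i ≡ residue j → a ∣ (j ∸ i) * d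
  residue-≡⇒∣ {i} {j} i≤j eq = m%n≡[m+o]%n⇒n∣o (b + i * d) ((j ∸ i) * d) (begin
    (b + i * d) % a                  ≡⟨ eq ⟩
    (b + j * d) % a                  ≡⟨ cong (λ x → (b + x * d) % a) (sym (m∸n+n≡m i≤j)) ⟩
    (b + (j ∸ i + i) * d) % a        ≡⟨ cong (_% a) (b+[m+n]*d≡b+n*d+m*d b (j ∸ i) i d) ⟩
    (b + i * d + (j ∸ i) * d) % a    ∎)
    where open ≡-Reasoning

  residues-distinct : Coprime a d → ∀ {i j} → i < j → j < a → residue i ≢ residue j
  residues-distinct coprime {i} {j} i<j j<a eq = <-irrefl refl (begin-strict
    a      ≤⟨ ∣⇒≤ {{>-nonZero (m<n⇒0<n∸m i<j)}} a∣j∸i ⟩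
    j ∸ i  ≤⟨ m∸n≤m j i ⟩
    j      <⟨ j<a ⟩
    a      ∎)
    where
    open ≤-Reasoning
    a∣j∸i : a ∣ j ∸ i
    a∣j∸i = coprime-divisor coprime (subst (a ∣_) (*-comm (j ∸ i) d) (residue-≡⇒∣ (<⇒≤ i<j) eq))

  residues-injective : Coprime a d → InjectiveBelow a residue
  residues-injective coprime {i} {j} i<a j<a eq with <-cmp i j
  ... | tri< i<j _ _ = ⊥-elim (residues-distinct coprime i<j j<a eq)
  ... | tri≈ _ i≡j _ = i≡j
  ... | tri> _ _ j<i = ⊥-elim (residues-distinct coprime j<i i<a (sym eq))

  gcd∣count-residues : ∀ (p : ℕ → Bool) → gcd a d ∣ count (λ i → p (residue i)) a
  gcd∣count-residues p with gcd[m,n]∣m a d | gcd[m,n]∣n a d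
  ... | divides q a≡q*g | divides q′ d≡q′*g = divides (count P q) (begin
    count P a                ≡⟨ cong (count P) (trans a≡q*g (*-comm q g)) ⟩
    count P (g * q)          ≡⟨ sumBelow-periodic _ q (λ i → cong (λ x → indicator (p x)) (residue-periodic {q} a∣q*d i)) g ⟩
    g * count P q            ≡⟨ *-comm g _ ⟩
    count P q * g            ∎)
    where
    open ≡-Reasoning
    g : ℕ
    g = gcd a d
    P : ℕ → Bool
    P i = p (residue i)
    a∣q*d : a ∣ q * d
    a∣q*d = divides q′ (begin
      q * d          ≡⟨ cong (q *_) d≡q′*g ⟩
      q * (q′ * g)   ≡⟨ x∙yz≈y∙xz q q′ g ⟩
      q′ * (q * g)   ≡⟨ cong (q′ *_) (sym a≡q*g) ⟩
      q′ * a         ∎)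

-- Written with if_then_else_ so that f k is definitionally negativeIf ∘ (λ j → j % suc k <ᵇ _).
negativeIf : Bool → ℤ
negativeIf x = if x then - (+ 1) else + 1

apSum-negativeIf : ∀ (p : ℕ → Bool) b d n →
  apSum (λ j → negativeIf (p j)) b d n ℤ.+ + (count (λ i → p (b + i * d)) n * 2) ≡ + n
apSum-negativeIf p b d zero    = refl
apSum-negativeIf p b d (suc n) with p (b + n * d)
... | false = begin
  (+ 1 ℤ.+ A) ℤ.+ X  ≡⟨ ℤP.+-assoc (+ 1) A X ⟩
  + 1 ℤ.+ (A ℤ.+ X)  ≡⟨ cong (λ s → + 1 ℤ.+ s) (apSum-negativeIf p b d n) ⟩
  + suc n            ∎
  where
  open ≡-Reasoning
  A X : ℤ
  A = apSum (λ j → negativeIf (p j)) b d n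
  X = + (count (λ i → p (b + i * d)) n * 2)
... | true  = begin
  (- + 1 ℤ.+ A) ℤ.+ (+ 2 ℤ.+ X)  ≡⟨ rearrange A X ⟩
  + 1 ℤ.+ (A ℤ.+ X)              ≡⟨ cong (λ s → + 1 ℤ.+ s) (apSum-negativeIf p b d n) ⟩
  + suc n                        ∎
  where
  open ≡-Reasoning
  A X : ℤ
  A = apSum (λ j → negativeIf (p j)) b d n
  X = + (count (λ i → p (b + i * d)) n * 2)
  rearrange : ∀ A X → (- + 1 ℤ.+ A) ℤ.+ (+ 2 ℤ.+ X) ≡ + 1 ℤ.+ (A ℤ.+ X)
  rearrange = solve-∀ℤ

1+m*2-coprime-indicator+m : ∀ m x → Coprime (suc (m * 2)) (indicator x + m)
1+m*2-coprime-indicator+m m false {g} (g∣1+2m , g∣m) =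
  ∣1⇒≡1 (∣m+n∣m⇒∣n (subst (g ∣_) (+-comm 1 (m * 2)) g∣1+2m) (∣m⇒∣m*n 2 g∣m))
1+m*2-coprime-indicator+m m true  {g} (g∣1+2m , g∣1+m) =
  ∣1⇒≡1 (∣m+n∣m⇒∣n (subst (g ∣_) (+-comm 1 (suc (m * 2))) (∣m⇒∣m*n 2 g∣1+m)) g∣1+2m)

k≡[k+1]/2*2 : ∀ k → (k + 1) % 2 ≡ 1 → k ≡ (k + 1) / 2 * 2
k≡[k+1]/2*2 k odd = suc-injective (begin
  suc k                          ≡⟨ +-comm 1 k ⟩
  k + 1                          ≡⟨ m≡m%n+[m/n]*n (k + 1) 2 ⟩
  (k + 1) % 2 + (k + 1) / 2 * 2  ≡⟨ cong (λ r → r + (k + 1) / 2 * 2) odd ⟩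
  suc ((k + 1) / 2 * 2)          ∎)
  where open ≡-Reasoning

apSum-f≢0 : ∀ t b d → apSum (f (suc t * 2)) b d (suc t * 2) ≢ + 0
apSum-f≢0 t b d sum≡0 = <-irrefl refl (begin-strict
  suc t       ≡⟨ sym C[k]≡1+t ⟩
  count P k   ≤⟨ m≤n+m (count P k) (indicator (P k)) ⟩
  count P a   ≤⟨ count-<ᵇ-≤ a (residues-injective a b d coprime) τ ⟩
  τ           ≡⟨ m*n/n≡m t 2 ⟩
  t           <⟨ n<1+n t ⟩
  suc t       ∎)
  where
  open ≤-Reasoning
  k a τ : ℕ
  k = suc t * 2
  a = suc k
  τ = (a ∸ 3) / 2
  P : ℕ → Bool
  P i = residue a b d i <ᵇ τ
  C[k]≡1+t : count P k ≡ suc t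
  C[k]≡1+t = sym (*-cancelʳ-≡ (suc t) (count P k) 2 (ℤP.+-injective k≡C[k]*2))
    where
    k≡C[k]*2 : + k ≡ + (count P k * 2)
    k≡C[k]*2 = trans (sym (apSum-negativeIf (λ j → j % a <ᵇ τ) b d k))
                     (cong (λ s → s ℤ.+ + (count P k * 2)) sum≡0)
  coprime : Coprime a d
  coprime = gcd≡1⇒coprime (1+m*2-coprime-indicator+m (suc t) (P k)
    (gcd[m,n]∣m a d , subst (λ c → gcd a d ∣ indicator (P k) + c) C[k]≡1+t (gcd∣count-residues a b d (_<ᵇ τ))))

corollary3p11 : (k : ℕ) → 0 < k → (k + 1) % 2 ≡ 1 →
    (b d : ℕ) → 0 < d → b + (k ∸ 1) * d < nOf k →
    apSum (f k) b d k ≢ + 0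
corollary3p11 k 0<k odd b d _ _ with (k + 1) / 2 | k≡[k+1]/2*2 k odd
... | zero  | refl = ⊥-elim (<-irrefl refl 0<k)
... | suc t | refl = apSum-f≢0 t b d
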